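{- Let $\mathsf{D}$ be an optiongraph and let $\phi,\psi$ be congruence relations on $\mathsf{D}$. Then the transitive closure of $\phi\cup\psi$ is a congruence relation on $\mathsf{D}$.
   Context: An optiongraph is a nonempty set $\mathsf{D}$ (of positions, possibly infinite) together with an option function $\mathrm{Opt}:\mathsf{D}\to 2^{\mathsf{D}}$. For an equivalence relation $\theta$ on $\mathsf{D}$, write $[p]_\theta$ for the class of $p$ and $[S]_\theta:=\{[s]_\theta\mid s\in S\}$. An equivalence relation $\theta$ on $\mathsf{D}$ is a congruence relation if $p\mathrel{\theta}q$ implies $[\mathrm{Opt}(p)]_\theta=[\mathrm{Opt}(q)]_\theta$. -}

module Defs where

open import Level using (Level; suc)
open import Data.Product using (Σ; _×_; _,_)
open import Relation.Unary using (Pred; _∈_; Satisfiable)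
open import Relation.Binary.Core using (Rel)
open import Relation.Binary.Structures using (IsEquivalence)

record Optiongraph (a : Level) : Set (suc a) where
  field
    Pos      : Set a
    nonempty : Pos
    Opt      : Pos → Pred Pos a

-- [S]_θ = [T]_θ : the sets of θ-classes of S and T coincide, i.e.
-- every element of S is θ-related to some element of T and vice versa.
ClassImageEq : ∀ {a} {A : Set a} → Rel A a → Pred A a → Pred A a → Set a
ClassImageEq θ S T =
  (∀ s → s ∈ S → Σ _ λ t → t ∈ T × θ s t) ×
  (∀ t → t ∈ T → Σ _ λ s → s ∈ S × θ s t)

record IsCongruence {a} (G : Optiongraph a) (θ : Rel (Optiongraph.Pos G) a) : Set a where
  open Optiongraph G
  field
    isEquivalence : IsEquivalence θ
    compatible    : ∀ {p q} → θ p q → ClassImageEq θ (Opt p) (Opt q)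

{-# OPTIONS --safe #-}
-- A single φ- or ψ-step p ~ q matches the options of p and q up to φ or ψ, hence up to
-- the closure T; since T is transitive, so is matching up to T, and chaining the matchings
-- along a T-path shows that T is compatible.
module Submission where

open import Defs
open import Level using (Level)
open import Data.Product using (_,_)
open import Data.Sum using (inj₁; inj₂)
open import Relation.Binary.Core using (Rel; _⇒_)
open import Relation.Binary.Definitions using (Reflexive; Symmetric; Transitive)
open import Relation.Binary.Structures using (IsEquivalence)
open import Relation.Binary.Construct.Union using (_∪_)
import Relation.Binary.Construct.Union as Union
open import Relation.Binary.Construct.Closure.Transitive
  using (TransClosure; [_]; _∷_; _++_; symmetric)

private
  variable
    a ℓ : Level
    A : Set a

transClosure-least : {R S : Rel A ℓ} → Transitive S → R ⇒ S → TransClosure R ⇒ S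
transClosure-least trans R⇒S [ r ]    = R⇒S r
transClosure-least trans R⇒S (r ∷ rs) = trans (R⇒S r) (transClosure-least trans R⇒S rs)

transClosure-isEquivalence : {R : Rel A ℓ} → Reflexive R → Symmetric R →
                             IsEquivalence (TransClosure R)
transClosure-isEquivalence {R = R} refl sym = record
  { refl  = [ refl ]
  ; sym   = symmetric R sym
  ; trans = _++_
  }

module _ {A : Set a} {θ θ′ : Rel A a} where

  ClassImageEq-mono : θ ⇒ θ′ → ClassImageEq θ ⇒ ClassImageEq θ′
  ClassImageEq-mono θ⇒θ′ (forth , back) =
      (λ s s∈S → let t , t∈T , sθt = forth s s∈S in t , t∈T , θ⇒θ′ sθt)
    , (λ t t∈T → let s , s∈S , sθt = back t t∈T in s , s∈S , θ⇒θ′ sθt)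

module _ {A : Set a} {θ : Rel A a} where

  ClassImageEq-trans : Transitive θ → Transitive (ClassImageEq θ)
  ClassImageEq-trans trans (forthₗ , backₗ) (forthᵣ , backᵣ) =
      (λ s s∈S → let t , t∈T , sθt = forthₗ s s∈S
                     u , u∈U , tθu = forthᵣ t t∈T
                 in u , u∈U , trans sθt tθu)
    , (λ u u∈U → let t , t∈T , tθu = backᵣ u u∈U
                     s , s∈S , sθt = backₗ t t∈T
                 in s , s∈S , trans sθt tθu)

module _ (G : Optiongraph a) where
  open Optiongraph G

  OptionsMatch : Rel Pos a → Rel Pos a
  OptionsMatch θ p q = ClassImageEq θ (Opt p) (Opt q)

  transClosure-compatible : {R : Rel Pos a} → R ⇒ OptionsMatch (TransClosure R) →
                            TransClosure R ⇒ OptionsMatch (TransClosure R)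
  transClosure-compatible = transClosure-least (ClassImageEq-trans _++_)

  ∪-compatible : {φ ψ : Rel Pos a} → IsCongruence G φ → IsCongruence G ψ →
                 φ ∪ ψ ⇒ OptionsMatch (TransClosure (φ ∪ ψ))
  ∪-compatible cφ cψ (inj₁ pφq) =
    ClassImageEq-mono (λ r → [ inj₁ r ]) (IsCongruence.compatible cφ pφq)
  ∪-compatible cφ cψ (inj₂ pψq) =
    ClassImageEq-mono (λ r → [ inj₂ r ]) (IsCongruence.compatible cψ pψq)

mainTheorem6 : ∀ {a} (G : Optiongraph a) (φ ψ : Rel (Optiongraph.Pos G) a) →
    IsCongruence G φ → IsCongruence G ψ → IsCongruence G (TransClosure (φ ∪ ψ))
mainTheorem6 G φ ψ cφ cψ = record
  { isEquivalence = transClosure-isEquivalence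
                      (inj₁ Φ.refl) (Union.symmetric {L = φ} {R = ψ} Φ.sym Ψ.sym)
  ; compatible    = transClosure-compatible G (∪-compatible G cφ cψ)
  }
  where
  module Φ = IsEquivalence (IsCongruence.isEquivalence cφ)
  module Ψ = IsEquivalence (IsCongruence.isEquivalence cψ)
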